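{- For $n\geq5$, the third distance ideal of the directed circuit $\overrightarrow{C_n}$ is $I_3(\overrightarrow{C_n})=\langle x_1,x_2,\dots,x_n,n\rangle\subseteq\mathbb{Z}[x_1,\dots,x_n]$.
   Context: $\overrightarrow{C_n}$ has vertices $v_1,\dots,v_n$ and arcs $(v_i,v_{i+1})$ for $1\leq i<n$ and $(v_n,v_1)$; its distance matrix $D$ has $(i,j)$-entry $(j-i)\bmod n\in\{0,\dots,n-1\}$. With indeterminate $x_i$ attached to $v_i$, $D_X(\overrightarrow{C_n})=\operatorname{diag}(x_1,\dots,x_n)+D$, and $I_3(\overrightarrow{C_n})$ is the ideal of $\mathbb{Z}[x_1,\dots,x_n]$ generated by all $3\times3$ minors of $D_X(\overrightarrow{C_n})$. -}

module Defs where

open import Data.Nat as ℕ using (ℕ; _≤?_; _∸_)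
open import Data.Integer as ℤ using (ℤ; +_)
open import Data.Fin as Fin using (Fin; toℕ; _<_; _≟_)
open import Data.Sum using (_⊎_; inj₁; inj₂)
open import Data.Unit using (⊤)
open import Relation.Nullary using (yes; no)
open import Data.Product using (_×_; _,_)

infixl 6 _⊕_
infixl 7 _⊗_
infix 4 _≈_

-- Polynomial expressions over ℤ in the variables x_0 … x_{n-1}
-- (paper's x_1 … x_n, indexed by Fin n).
data Poly (n : ℕ) : Set where
  var : Fin n → Poly n
  con : ℤ → Poly n
  _⊕_ : Poly n → Poly n → Poly n
  _⊗_ : Poly n → Poly n → Poly n
  ⊖_  : Poly n → Poly n

-- The congruence presenting ℤ[x_1,…,x_n] as the free commutative ring
-- generated by the variables over ℤ (constants form a ring homomorphism).
data _≈_ {n : ℕ} : Poly n → Poly n → Set where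
  ≈-refl  : ∀ {p} → p ≈ p
  ≈-sym   : ∀ {p q} → p ≈ q → q ≈ p
  ≈-trans : ∀ {p q r} → p ≈ q → q ≈ r → p ≈ r
  ⊕-cong  : ∀ {p p' q q'} → p ≈ p' → q ≈ q' → p ⊕ q ≈ p' ⊕ q'
  ⊗-cong  : ∀ {p p' q q'} → p ≈ p' → q ≈ q' → p ⊗ q ≈ p' ⊗ q'
  ⊖-cong  : ∀ {p p'} → p ≈ p' → ⊖ p ≈ ⊖ p'
  ⊕-assoc : ∀ p q r → (p ⊕ q) ⊕ r ≈ p ⊕ (q ⊕ r)
  ⊕-comm  : ∀ p q → p ⊕ q ≈ q ⊕ p
  ⊕-idˡ   : ∀ p → con (+ 0) ⊕ p ≈ p
  ⊖-invˡ  : ∀ p → (⊖ p) ⊕ p ≈ con (+ 0)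
  ⊗-assoc : ∀ p q r → (p ⊗ q) ⊗ r ≈ p ⊗ (q ⊗ r)
  ⊗-comm  : ∀ p q → p ⊗ q ≈ q ⊗ p
  ⊗-idˡ   : ∀ p → con (+ 1) ⊗ p ≈ p
  distribˡ : ∀ p q r → p ⊗ (q ⊕ r) ≈ (p ⊗ q) ⊕ (p ⊗ r)
  con-+   : ∀ a b → con (a ℤ.+ b) ≈ con a ⊕ con b
  con-*   : ∀ a b → con (a ℤ.* b) ≈ con a ⊗ con b
  con-neg : ∀ a → con (ℤ.- a) ≈ ⊖ con a

data InIdeal {n : ℕ} {I : Set} (g : I → Poly n) : Poly n → Set where
  gen  : ∀ i → InIdeal g (g i)
  zero : InIdeal g (con (+ 0))
  add  : ∀ {p q} → InIdeal g p → InIdeal g q → InIdeal g (p ⊕ q)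
  mul  : ∀ r {p} → InIdeal g p → InIdeal g (r ⊗ p)
  resp : ∀ {p q} → p ≈ q → InIdeal g p → InIdeal g q

_≐_ : ∀ {n} {I J : Set} → (I → Poly n) → (J → Poly n) → Set
g ≐ h = ∀ p → (InIdeal g p → InIdeal h p) × (InIdeal h p → InIdeal g p)

-- distance in the directed circuit: (j - i) mod n
dist : ∀ {n} → Fin n → Fin n → ℕ
dist {n} i j with toℕ i ≤? toℕ j
... | yes _ = toℕ j ∸ toℕ i
... | no  _ = (n ℕ.+ toℕ j) ∸ toℕ i

DX : ∀ n → Fin n → Fin n → Poly n
DX n i j = diagE ⊕ con (+ dist i j)
  where
  diagE : Poly n
  diagE with i ≟ j
  ... | yes _ = var i
  ... | no  _ = con (+ 0)

det3 : ∀ {n} → (Fin 3 → Fin 3 → Poly n) → Poly n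
det3 M =
    (a 0 0 ⊗ a 1 1 ⊗ a 2 2) ⊕ (a 0 1 ⊗ a 1 2 ⊗ a 2 0) ⊕ (a 0 2 ⊗ a 1 0 ⊗ a 2 1)
  ⊕ ⊖ ((a 0 2 ⊗ a 1 1 ⊗ a 2 0) ⊕ (a 0 0 ⊗ a 1 2 ⊗ a 2 1) ⊕ (a 0 1 ⊗ a 1 0 ⊗ a 2 2))
  where
  idx : ℕ → Fin 3
  idx 0 = Fin.zero
  idx 1 = Fin.suc Fin.zero
  idx _ = Fin.suc (Fin.suc Fin.zero)
  a : ℕ → ℕ → _
  a i j = M (idx i) (idx j)

record Sub3 (n : ℕ) : Set where
  constructor sub3
  field
    s₀ s₁ s₂ : Fin n
    lt₀₁ : s₀ < s₁
    lt₁₂ : s₁ < s₂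

pick : ∀ {n} → Sub3 n → Fin 3 → Fin n
pick s Fin.zero = Sub3.s₀ s
pick s (Fin.suc Fin.zero) = Sub3.s₁ s
pick s (Fin.suc (Fin.suc _)) = Sub3.s₂ s

minors3 : ∀ n → Sub3 n × Sub3 n → Poly n
minors3 n (r , c) = det3 (λ i j → DX n (pick r i) (pick c j))

rhsGens : ∀ n → Fin n ⊎ ⊤ → Poly n
rhsGens n (inj₁ i) = var i
rhsGens n (inj₂ _) = con (+ n)

{-# OPTIONS --safe #-}
module Submission where

-- Modulo ⟨x, n⟩ the (i, j) entry of D_X is j − i, so every 3×3 minor is congruent to the
-- determinant of a matrix (v_b − u_a) of rank at most 2, which vanishes.  Conversely, for
-- n ≥ 5 a handful of explicit minors on the rows and columns 0,…,4 and n − 1 equal x₀, x₁, x₂,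
-- x₀ − n and x₃ − n, and for i ≥ 4 the minor on rows {2, 3, i} and columns {0, 1, i} is x_i.

open import Defs
open import Data.Nat using (ℕ; _≤_)
open import Data.Product using (_×_; _,_)

open import Algebra.Bundles using (CommutativeRing)
open import Algebra.Definitions using (Congruent₁; Congruent₂)
open import Algebra.Structures using (IsCommutativeRing)
open import Algebra.Solver.Ring.AlmostCommutativeRing
  using (fromCommutativeRing; _-Raw-AlmostCommutative⟶_)
import Algebra.Consequences.Setoid as Consequences
import Algebra.Solver.Ring as RingSolver
open import Data.Fin using (Fin; zero; suc; toℕ; fromℕ; #_; _↑ʳ_)
open import Data.Fin.Properties using (toℕ-injective; toℕ-fromℕ; toℕ<n)
import Data.Fin.Properties as Finₚ
open import Data.Integer as ℤ using (+_)
open import Data.Maybe using (Maybe; just; nothing)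
open import Data.Nat as ℕ using (suc; _+_; _<_; s≤s)
open import Data.Nat.Properties
  using (<-cmp; <⇒≤; <⇒≱; <-irrefl; ≤-refl; ≤-trans; +-comm; +-cancelʳ-≡; m∸n+n≡m; m≤m+n)
open import Data.Sum using (inj₁; inj₂)
open import Data.Unit using (tt)
open import Relation.Binary.Bundles using (Setoid)
open import Relation.Binary.Core using (Rel)
open import Relation.Binary.Definitions using (tri<; tri≈; tri>)
open import Relation.Binary.PropositionalEquality
  using (_≡_; refl; cong; sym; subst; module ≡-Reasoning)
open import Relation.Nullary using (yes; no; contradiction)
open import Relation.Nullary.Decidable using (True; toWitness)

≈-setoid : ℕ → Setoid _ _
≈-setoid n = record
  { Carrier       = Poly n
  ; _≈_           = _≈_
  ; isEquivalence = record { refl = ≈-refl ; sym = ≈-sym ; trans = ≈-trans }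
  }

Poly-isCommutativeRing : ∀ n → IsCommutativeRing (_≈_ {n}) _⊕_ _⊗_ ⊖_ (con (+ 0)) (con (+ 1))
Poly-isCommutativeRing n = record
  { isRing = record
    { +-isAbelianGroup = record
      { isGroup = record
        { isMonoid = record
          { isSemigroup = record
            { isMagma = record
              { isEquivalence = Setoid.isEquivalence (≈-setoid n)
              ; ∙-cong        = ⊕-cong
              }
            ; assoc = ⊕-assoc
            }
          ; identity = comm∧idˡ⇒id ⊕-comm ⊕-idˡ
          }
        ; inverse = comm∧invˡ⇒inv ⊕-comm ⊖-invˡ
        ; ⁻¹-cong = ⊖-cong
        }
      ; comm = ⊕-comm
      }
    ; *-cong     = ⊗-cong
    ; *-assoc    = ⊗-assoc
    ; *-identity = comm∧idˡ⇒id ⊗-comm ⊗-idˡ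
    ; distrib    = comm∧distrˡ⇒distr ⊕-cong ⊗-comm distribˡ
    }
  ; *-comm = ⊗-comm
  }
  where open Consequences (≈-setoid n)

Poly-commutativeRing : ℕ → CommutativeRing _ _
Poly-commutativeRing n = record { isCommutativeRing = Poly-isCommutativeRing n }

module PolySolver (n : ℕ) where

  private
    con-homomorphism : ℤ.+-*-rawRing -Raw-AlmostCommutative⟶ fromCommutativeRing (Poly-commutativeRing n)
    con-homomorphism = record
      { ⟦_⟧    = con
      ; +-homo = con-+
      ; *-homo = con-*
      ; -‿homo = con-neg
      ; 0-homo = ≈-refl
      ; 1-homo = ≈-refl
      }

    con-≟ : ∀ a b → Maybe (con {n} a ≈ con b)
    con-≟ a b with a ℤ.≟ b
    ... | yes refl = just ≈-refl
    ... | no _     = nothing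

  open RingSolver ℤ.+-*-rawRing (fromCommutativeRing (Poly-commutativeRing n)) con-homomorphism con-≟ public

  num : ∀ {k} → ℕ → Polynomial k
  num a = con (+ a)

con-cong : ∀ {n} {a b : ℕ} → a ≡ b → con {n} (+ a) ≈ con (+ b)
con-cong refl = ≈-refl

InIdeal-⊆ : ∀ {n} {I J : Set} {g : I → Poly n} {h : J → Poly n} →
            (∀ i → InIdeal h (g i)) → ∀ {p} → InIdeal g p → InIdeal h p
InIdeal-⊆ g⊆h (gen i)       = g⊆h i
InIdeal-⊆ g⊆h zero          = zero
InIdeal-⊆ g⊆h (add p∈ q∈)   = add (InIdeal-⊆ g⊆h p∈) (InIdeal-⊆ g⊆h q∈)
InIdeal-⊆ g⊆h (mul r p∈)    = mul r (InIdeal-⊆ g⊆h p∈)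
InIdeal-⊆ g⊆h (resp p≈q p∈) = resp p≈q (InIdeal-⊆ g⊆h p∈)

infix 4 _∼_mod_

_∼_mod_ : ∀ {n} {I : Set} → Poly n → Poly n → (I → Poly n) → Set
p ∼ q mod g = InIdeal g (p ⊕ ⊖ q)

module _ {n} {I : Set} {g : I → Poly n} where
  open PolySolver n

  gen-resp : ∀ i {p} → g i ≈ p → InIdeal g p
  gen-resp i gᵢ≈p = resp gᵢ≈p (gen i)

  ∼-sym : ∀ {p q} → p ∼ q mod g → q ∼ p mod g
  ∼-sym {p} {q} p∼q =
    resp (solve 2 (λ p q → (:- num 1) :* (p :- q) := q :- p) ≈-refl p q) (mul (⊖ con (+ 1)) p∼q)

  ∼-⊕ : Congruent₂ (λ p q → p ∼ q mod g) _⊕_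
  ∼-⊕ {x} {y} {u} {v} x∼y u∼v =
    resp (solve 4 (λ x y u v → (x :- y) :+ (u :- v) := (x :+ u) :- (y :+ v)) ≈-refl x y u v)
         (add x∼y u∼v)

  ∼-⊗ : Congruent₂ (λ p q → p ∼ q mod g) _⊗_
  ∼-⊗ {x} {y} {u} {v} x∼y u∼v =
    resp (solve 4 (λ x y u v → u :* (x :- y) :+ y :* (u :- v) := x :* u :- y :* v) ≈-refl x y u v)
         (add (mul u x∼y) (mul y u∼v))

  ∼-⊖ : Congruent₁ (λ p q → p ∼ q mod g) ⊖_
  ∼-⊖ {x} {y} x∼y =
    resp (solve 2 (λ x y → (:- num 1) :* (x :- y) := :- x :- :- y) ≈-refl x y) (mul (⊖ con (+ 1)) x∼y)

  ≈+∈⇒∼ : ∀ {p q h} → p ≈ q ⊕ h → InIdeal g h → p ∼ q mod g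
  ≈+∈⇒∼ {p} {q} {h} p≈q+h h∈ =
    resp (≈-sym (≈-trans (⊕-cong p≈q+h ≈-refl) (solve 2 (λ q h → q :+ h :- q := h) ≈-refl q h))) h∈

  ∼-∈ : ∀ {p q} → p ∼ q mod g → InIdeal g q → InIdeal g p
  ∼-∈ {p} {q} p∼q q∈ = resp (solve 2 (λ p q → (p :- q) :+ q := p) ≈-refl p q) (add p∼q q∈)

-- The shape of det3, over an arbitrary carrier so that it can also be written in solver syntax.
leibniz₃ : {A : Set} → (A → A → A) → (A → A → A) → (A → A) → A → A → A → A → A → A → A → A → A → A
leibniz₃ _+_ _*_ -_ a₀₀ a₀₁ a₀₂ a₁₀ a₁₁ a₁₂ a₂₀ a₂₁ a₂₂ =
  ((((a₀₀ * a₁₁) * a₂₂) + ((a₀₁ * a₁₂) * a₂₀)) + ((a₀₂ * a₁₀) * a₂₁))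
  + (- ((((a₀₂ * a₁₁) * a₂₀) + ((a₀₀ * a₁₂) * a₂₁)) + ((a₀₁ * a₁₀) * a₂₂)))

module Det3Congruence {n} {ℓ} {R : Rel (Poly n) ℓ}
         (R-⊕ : Congruent₂ R _⊕_) (R-⊗ : Congruent₂ R _⊗_) (R-⊖ : Congruent₁ R ⊖_) where

  leibniz₃-cong : ∀ {a₀₀ a₀₁ a₀₂ a₁₀ a₁₁ a₁₂ a₂₀ a₂₁ a₂₂ b₀₀ b₀₁ b₀₂ b₁₀ b₁₁ b₁₂ b₂₀ b₂₁ b₂₂} →
    R a₀₀ b₀₀ → R a₀₁ b₀₁ → R a₀₂ b₀₂ → R a₁₀ b₁₀ → R a₁₁ b₁₁ → R a₁₂ b₁₂ → R a₂₀ b₂₀ → R a₂₁ b₂₁ → R a₂₂ b₂₂ →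
    R (leibniz₃ _⊕_ _⊗_ ⊖_ a₀₀ a₀₁ a₀₂ a₁₀ a₁₁ a₁₂ a₂₀ a₂₁ a₂₂)
      (leibniz₃ _⊕_ _⊗_ ⊖_ b₀₀ b₀₁ b₀₂ b₁₀ b₁₁ b₁₂ b₂₀ b₂₁ b₂₂)
  leibniz₃-cong e₀₀ e₀₁ e₀₂ e₁₀ e₁₁ e₁₂ e₂₀ e₂₁ e₂₂ =
    R-⊕ (R-⊕ (R-⊕ (R-⊗ (R-⊗ e₀₀ e₁₁) e₂₂) (R-⊗ (R-⊗ e₀₁ e₁₂) e₂₀)) (R-⊗ (R-⊗ e₀₂ e₁₀) e₂₁))
        (R-⊖ (R-⊕ (R-⊕ (R-⊗ (R-⊗ e₀₂ e₁₁) e₂₀) (R-⊗ (R-⊗ e₀₀ e₁₂) e₂₁)) (R-⊗ (R-⊗ e₀₁ e₁₀) e₂₂)))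

  det3-cong : ∀ {M M′ : Fin 3 → Fin 3 → Poly n} → (∀ a b → R (M a b) (M′ a b)) → R (det3 M) (det3 M′)
  det3-cong e = leibniz₃-cong (e (# 0) (# 0)) (e (# 0) (# 1)) (e (# 0) (# 2))
                              (e (# 1) (# 0)) (e (# 1) (# 1)) (e (# 1) (# 2))
                              (e (# 2) (# 0)) (e (# 2) (# 1)) (e (# 2) (# 2))

det3[vⱼ-uᵢ]≈0 : ∀ {n} (u v : Fin 3 → Poly n) → det3 (λ i j → v j ⊕ ⊖ u i) ≈ con (+ 0)
det3[vⱼ-uᵢ]≈0 {n} u v =
  solve 6 (λ u₀ u₁ u₂ v₀ v₁ v₂ → leibniz₃ _:+_ _:*_ :-_
             (v₀ :- u₀) (v₁ :- u₀) (v₂ :- u₀)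
             (v₀ :- u₁) (v₁ :- u₁) (v₂ :- u₁)
             (v₀ :- u₂) (v₁ :- u₂) (v₂ :- u₂) := num 0)
        ≈-refl (u (# 0)) (u (# 1)) (u (# 2)) (v (# 0)) (v (# 1)) (v (# 2))
  where open PolySolver n

dist[i,j]+i≡j : ∀ {n} {i j : Fin n} → toℕ i ℕ.≤ toℕ j → dist i j + toℕ i ≡ toℕ j
dist[i,j]+i≡j {i = i} {j} i≤j with toℕ i ℕ.≤? toℕ j
... | yes _   = m∸n+n≡m i≤j
... | no  i≰j = contradiction i≤j i≰j

dist[i,j]+i≡n+j : ∀ {n} {i j : Fin n} → toℕ j < toℕ i → dist i j + toℕ i ≡ n + toℕ j
dist[i,j]+i≡n+j {n} {i} {j} j<i with toℕ i ℕ.≤? toℕ j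
... | yes i≤j = contradiction i≤j (<⇒≱ j<i)
... | no  _   = m∸n+n≡m (≤-trans (<⇒≤ (toℕ<n i)) (m≤m+n n (toℕ j)))

dist[last,j]≡1+j : ∀ {k} {j : Fin (suc k)} → toℕ j < k → dist (fromℕ k) j ≡ suc (toℕ j)
dist[last,j]≡1+j {k} {j} j<k = +-cancelʳ-≡ k (dist (fromℕ k) j) (suc (toℕ j)) (begin
  dist (fromℕ k) j + k              ≡⟨ cong (λ x → dist (fromℕ k) j + x) (sym (toℕ-fromℕ k)) ⟩
  dist (fromℕ k) j + toℕ (fromℕ k) ≡⟨ dist[i,j]+i≡n+j (subst (toℕ j <_) (sym (toℕ-fromℕ k)) j<k) ⟩
  suc k + toℕ j                     ≡⟨ cong suc (+-comm k (toℕ j)) ⟩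
  suc (toℕ j) + k                   ∎)
  where open ≡-Reasoning

DX-last-row : ∀ {k} {j : Fin (suc k)} → toℕ j < k → DX (suc k) (fromℕ k) j ≈ con (+ suc (toℕ j))
DX-last-row {k} {j} j<k with fromℕ k Finₚ.≟ j
... | yes refl = contradiction (subst (_< k) (toℕ-fromℕ k) j<k) (<-irrefl refl)
... | no  _    = ≈-trans (⊕-idˡ _) (con-cong (dist[last,j]≡1+j j<k))

module _ {n : ℕ} where
  open CommutativeRing (Poly-commutativeRing n) using (+-identityʳ)
  open PolySolver n

  con-difference : ∀ {a b c} → a + b ≡ c → con {n} (+ a) ≈ con (+ c) ⊕ ⊖ con (+ b)
  con-difference {a} {b} refl =
    ≈-trans (solve 2 (λ A B → A := (A :+ B) :- B) ≈-refl (con (+ a)) (con (+ b)))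
            (⊕-cong (≈-sym (con-+ (+ a) (+ b))) ≈-refl)

  DX-diag : ∀ (i : Fin n) → DX n i i ≈ var i
  DX-diag i with i Finₚ.≟ i
  ... | no  i≢i = contradiction refl i≢i
  ... | yes _   = ≈-trans (⊕-cong ≈-refl (con-cong dist[i,i]≡0)) (+-identityʳ (var i))
    where
    dist[i,i]≡0 : dist i i ≡ 0
    dist[i,i]≡0 = +-cancelʳ-≡ (toℕ i) (dist i i) 0 (dist[i,j]+i≡j ≤-refl)

  DX-above : ∀ {i j : Fin n} → toℕ i < toℕ j → DX n i j ≈ con (+ toℕ j) ⊕ ⊖ con (+ toℕ i)
  DX-above {i} {j} i<j with i Finₚ.≟ j
  ... | yes refl = contradiction i<j (<-irrefl refl)
  ... | no  _    = ≈-trans (⊕-idˡ _) (con-difference (dist[i,j]+i≡j (<⇒≤ i<j)))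

  DX-below : ∀ {i j : Fin n} → toℕ j < toℕ i → DX n i j ≈ con (+ n) ⊕ con (+ toℕ j) ⊕ ⊖ con (+ toℕ i)
  DX-below {i} {j} j<i with i Finₚ.≟ j
  ... | yes refl = contradiction j<i (<-irrefl refl)
  ... | no  _    = ≈-trans (⊕-idˡ _) (≈-trans (con-difference (dist[i,j]+i≡n+j j<i))
                                              (⊕-cong (con-+ (+ n) (+ toℕ j)) ≈-refl))

  DX∼j-i : ∀ (i j : Fin n) → DX n i j ∼ con (+ toℕ j) ⊕ ⊖ con (+ toℕ i) mod rhsGens n
  DX∼j-i i j with <-cmp (toℕ i) (toℕ j)
  ... | tri< i<j _ _ =
    ≈+∈⇒∼ (≈-trans (DX-above i<j) (solve 2 (λ J I → J :- I := (J :- I) :+ num 0) ≈-refl _ _)) zero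
  ... | tri> _ _ j<i =
    ≈+∈⇒∼ (≈-trans (DX-below j<i) (solve 3 (λ N J I → N :+ J :- I := (J :- I) :+ N) ≈-refl _ _ _))
          (gen (inj₂ tt))
  ... | tri≈ _ i≡j _ with toℕ-injective i≡j
  ...   | refl = ≈+∈⇒∼ (≈-trans (DX-diag i) (solve 2 (λ X I → X := (I :- I) :+ X) ≈-refl _ _)) (gen (inj₁ i))

minor∈⟨x,n⟩ : ∀ n (rc : Sub3 n × Sub3 n) → InIdeal (rhsGens n) (minors3 n rc)
minor∈⟨x,n⟩ n (r , c) =
  ∼-∈ (det3-cong (λ a b → DX∼j-i (pick r a) (pick c b)))
      (resp (≈-sym (det3[vⱼ-uᵢ]≈0 (λ a → con (+ toℕ (pick r a))) (λ b → con (+ toℕ (pick c b))))) zero)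
  where open Det3Congruence {R = λ p q → p ∼ q mod rhsGens n} ∼-⊕ ∼-⊗ ∼-⊖

⟨_,_,_⟩ : ∀ {n} (i j k : Fin n) {i<j : True (i Finₚ.<? j)} {j<k : True (j Finₚ.<? k)} → Sub3 n
⟨_,_,_⟩ i j k {i<j} {j<k} = sub3 i j k (toWitness i<j) (toWitness j<k)

module _ (m : ℕ) where

  private
    N : ℕ
    N = 5 + m

    last : Fin N
    last = fromℕ (4 + m)

    open PolySolver N
    open Det3Congruence {N} {R = _≈_} ⊕-cong ⊗-cong ⊖-cong using (leibniz₃-cong)

    diag : ∀ {i : Fin N} → DX N i i ≈ var i
    diag {i} = DX-diag i

    above : ∀ {i j : Fin N} {i<j : True (i Finₚ.<? j)} → DX N i j ≈ con (+ toℕ j) ⊕ ⊖ con (+ toℕ i)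
    above {i<j = i<j} = DX-above (toWitness i<j)

    below : ∀ {i j : Fin N} {j<i : True (j Finₚ.<? i)} → DX N i j ≈ con (+ N) ⊕ con (+ toℕ j) ⊕ ⊖ con (+ toℕ i)
    below {j<i = j<i} = DX-below (toWitness j<i)

    wrap : ∀ {j : Fin N} {j<last : True (toℕ j ℕ.<? 4 + m)} → DX N last j ≈ con (+ suc (toℕ j))
    wrap {j<last = j<last} = DX-last-row (toWitness j<last)

  x₀∈minors : InIdeal (minors3 N) (var (# 0))
  x₀∈minors = gen-resp (⟨ # 0 , # 3 , # 4 ⟩ , ⟨ # 0 , # 1 , # 2 ⟩) (≈-trans
    (leibniz₃-cong diag  above above below below below below below below)
    (solve 2 (λ X N → leibniz₃ _:+_ _:*_ :-_
        X                     (num 1 :- num 0)      (num 2 :- num 0)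
        (N :+ num 0 :- num 3) (N :+ num 1 :- num 3) (N :+ num 2 :- num 3)
        (N :+ num 0 :- num 4) (N :+ num 1 :- num 4) (N :+ num 2 :- num 4) := X)
      ≈-refl (var (# 0)) (con (+ N))))

  x₀∼n : var (# 0) ∼ con (+ N) mod minors3 N
  x₀∼n = gen-resp (⟨ # 0 , # 1 , # 2 ⟩ , ⟨ # 0 , # 3 , # 4 ⟩) (≈-trans
    (leibniz₃-cong diag  above above below above above below above above)
    (solve 2 (λ X N → leibniz₃ _:+_ _:*_ :-_
        X                     (num 3 :- num 0) (num 4 :- num 0)
        (N :+ num 0 :- num 1) (num 3 :- num 1) (num 4 :- num 1)
        (N :+ num 0 :- num 2) (num 3 :- num 2) (num 4 :- num 2) := X :- N)
      ≈-refl (var (# 0)) (con (+ N))))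

  x₁∈minors : InIdeal (minors3 N) (var (# 1))
  x₁∈minors = gen-resp (⟨ # 0 , # 1 , last ⟩ , ⟨ # 1 , # 2 , # 3 ⟩) (≈-trans
    (leibniz₃-cong above above above diag  above above wrap  wrap  wrap)
    (solve 1 (λ X → leibniz₃ _:+_ _:*_ :-_
        (num 1 :- num 0) (num 2 :- num 0) (num 3 :- num 0)
        X                (num 2 :- num 1) (num 3 :- num 1)
        (num 2)          (num 3)          (num 4)          := X)
      ≈-refl (var (# 1))))

  x₂∈minors : InIdeal (minors3 N) (var (# 2))
  x₂∈minors = gen-resp (⟨ # 0 , # 1 , # 2 ⟩ , ⟨ # 2 , # 3 , # 4 ⟩) (≈-trans
    (leibniz₃-cong above above above above above above diag  above above)
    (solve 1 (λ X → leibniz₃ _:+_ _:*_ :-_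
        (num 2 :- num 0) (num 3 :- num 0) (num 4 :- num 0)
        (num 2 :- num 1) (num 3 :- num 1) (num 4 :- num 1)
        X                (num 3 :- num 2) (num 4 :- num 2) := X)
      ≈-refl (var (# 2))))

  x₃∼n : var (# 3) ∼ con (+ N) mod minors3 N
  x₃∼n = gen-resp (⟨ # 0 , # 3 , last ⟩ , ⟨ # 1 , # 2 , # 3 ⟩) (≈-trans
    (leibniz₃-cong above above above below below diag  wrap  wrap  wrap)
    (solve 2 (λ X N → leibniz₃ _:+_ _:*_ :-_
        (num 1 :- num 0)      (num 2 :- num 0)      (num 3 :- num 0)
        (N :+ num 1 :- num 3) (N :+ num 2 :- num 3) X
        (num 2)               (num 3)               (num 4)          := X :- N)
      ≈-refl (var (# 3)) (con (+ N))))

  x₄₊∈minors : ∀ t → InIdeal (minors3 N) (var (4 ↑ʳ t))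
  x₄₊∈minors t = gen-resp (⟨ # 2 , # 3 , 4 ↑ʳ t ⟩ , ⟨ # 0 , # 1 , 4 ↑ʳ t ⟩) (≈-trans
    (leibniz₃-cong below below above below below above below below diag)
    (solve 3 (λ X N I → leibniz₃ _:+_ _:*_ :-_
        (N :+ num 0 :- num 2) (N :+ num 1 :- num 2) (I :- num 2)
        (N :+ num 0 :- num 3) (N :+ num 1 :- num 3) (I :- num 3)
        (N :+ num 0 :- I)     (N :+ num 1 :- I)     X            := X)
      ≈-refl (var (4 ↑ʳ t)) (con (+ N)) (con (+ toℕ (4 ↑ʳ t)))))

  n∈minors : InIdeal (minors3 N) (con (+ N))
  n∈minors = ∼-∈ (∼-sym x₀∼n) x₀∈minors

  var∈minors : ∀ i → InIdeal (minors3 N) (var i)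
  var∈minors zero                      = x₀∈minors
  var∈minors (suc zero)                = x₁∈minors
  var∈minors (suc (suc zero))          = x₂∈minors
  var∈minors (suc (suc (suc zero)))    = ∼-∈ x₃∼n n∈minors
  var∈minors (suc (suc (suc (suc t)))) = x₄₊∈minors t

  rhsGen∈minors : ∀ k → InIdeal (minors3 N) (rhsGens N k)
  rhsGen∈minors (inj₁ i) = var∈minors i
  rhsGen∈minors (inj₂ _) = n∈minors

theorem25 : ∀ (n : ℕ) → 5 ≤ n → minors3 n ≐ rhsGens n
theorem25 _ (s≤s (s≤s (s≤s (s≤s (s≤s {n = m} _))))) _ =
  InIdeal-⊆ (minor∈⟨x,n⟩ (5 + m)) , InIdeal-⊆ (rhsGen∈minors m)
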